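{- Let $f:G_\infty\to H$ be a homomorphism, where $H$ is a finite graph containing no $K_4$ subgraph and having no $K_5$ minor. Then there is some $m\ge 4$ and an embedding $\hat f:D_m\to H$ such that $f=\hat f\circ\delta_{\infty,m}$.
   Context: Graphs are simple and undirected. $G_\infty$ is the graph with vertex set $\{v_1,v_2\}\cup\{a_i:i\ge 1\}\cup\{b_i:i\ge 1\}$ and edges $(v_1,a_i)$, $(v_2,b_i)$, $(a_i,b_i)$, $(a_i,a_{i+1})$, $(b_i,b_{i+1})$, $(a_{i+1},b_i)$ for all $i\ge 1$. For $m\ge 3$, $D_m$ is the graph with vertex set $\{v_1,v_2\}\cup\{a_i,b_i:i\in[m]\}$ and edges $(v_1,a_i),(v_2,b_i),(a_i,b_i)$ for $i\in[m]$, $(a_i,a_{i+1}),(b_i,b_{i+1}),(a_{i+1},b_i)$ for $i\in[m-1]$, and $(a_1,a_m),(b_1,b_m),(a_1,b_m)$. $\delta_{\infty,m}:G_\infty\to D_m$ is the homomorphism $v_1\mapsto v_1$, $v_2\mapsto v_2$, $a_i\mapsto a_{i\bmod m}$, $b_i\mapsto b_{i\bmod m}$, with residues taken in $\{1,\dots,m\}$. An embedding is an injective homomorphism onto an induced subgraph. -}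

module Defs where

open import Data.Nat using (ℕ; zero; suc; NonZero)
open import Data.Nat.DivMod using (_mod_)
open import Data.Fin using (Fin; toℕ)
open import Data.Bool using (Bool; true; false)
open import Data.Product using (Σ; _×_; _,_; ∃)
open import Data.Sum using (_⊎_)
open import Relation.Binary.PropositionalEquality using (_≡_; _≢_)
open import Relation.Nullary using (¬_)
open import Function.Bundles using (_⇔_)

record FinGraph : Set where
  field
    n     : ℕ
    adj   : Fin n → Fin n → Bool
    sym   : ∀ u v → adj u v ≡ adj v u
    irrefl : ∀ u → adj u u ≡ false

open FinGraph public

Adj : (H : FinGraph) → Fin (n H) → Fin (n H) → Set
Adj H u v = adj H u v ≡ true

HasK4Subgraph : FinGraph → Set
HasK4Subgraph H =
  Σ (Fin 4 → Fin (n H)) λ g →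
    (∀ i j → g i ≡ g j → i ≡ j) × (∀ i j → i ≢ j → Adj H (g i) (g j))

data WalkIn (H : FinGraph) (S : Fin (n H) → Set) : Fin (n H) → Fin (n H) → Set where
  here : ∀ {u} → WalkIn H S u u
  step : ∀ {u w v} → Adj H u w → S w → WalkIn H S w v → WalkIn H S u v

HasK5Minor : FinGraph → Set
HasK5Minor H =
  Σ (Fin 5 → Fin (n H) → Bool) λ B →
      (∀ i j v → B i v ≡ true → B j v ≡ true → i ≡ j)
    × (∀ i → ∃ λ v → B i v ≡ true)
    × (∀ i u v → B i u ≡ true → B i v ≡ true →
                 WalkIn H (λ w → B i w ≡ true) u v)
    × (∀ i j → i ≢ j → Σ (Fin (n H)) λ u → Σ (Fin (n H)) λ v →
                           B i u ≡ true × B j v ≡ true × Adj H u v)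

-- G∞.  Indices are shifted to start at 0:  a i  stands for a_{i+1}.

data GV : Set where
  v₁ v₂ : GV
  a b   : ℕ → GV

data GArc : GV → GV → Set where
  v₁a : ∀ i → GArc v₁ (a i)
  v₂b : ∀ i → GArc v₂ (b i)
  ab  : ∀ i → GArc (a i) (b i)
  aa  : ∀ i → GArc (a i) (a (suc i))
  bb  : ∀ i → GArc (b i) (b (suc i))
  a'b : ∀ i → GArc (a (suc i)) (b i)

GEdge : GV → GV → Set
GEdge x y = GArc x y ⊎ GArc y x

-- D_m.  Indices in Fin m (0-based: a i stands for a_{i+1}); the edges
-- (a_1,a_m),(b_1,b_m),(a_1,b_m) are exactly the wrap-around instances of
-- the cyclic families below.

data DV (m : ℕ) : Set where
  v₁ v₂ : DV m
  a b   : Fin m → DV m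

next : (m : ℕ) .{{_ : NonZero m}} → Fin m → Fin m
next m i = suc (toℕ i) mod m

data DArc (m : ℕ) .{{_ : NonZero m}} : DV m → DV m → Set where
  v₁a : ∀ i → DArc m v₁ (a i)
  v₂b : ∀ i → DArc m v₂ (b i)
  ab  : ∀ i → DArc m (a i) (b i)
  aa  : ∀ i → DArc m (a i) (a (next m i))
  bb  : ∀ i → DArc m (b i) (b (next m i))
  a'b : ∀ i → DArc m (a (next m i)) (b i)

DEdge : (m : ℕ) .{{_ : NonZero m}} → DV m → DV m → Set
DEdge m x y = DArc m x y ⊎ DArc m y x

δ : (m : ℕ) .{{_ : NonZero m}} → GV → DV m
δ m v₁    = v₁
δ m v₂    = v₂
δ m (a i) = a (i mod m)
δ m (b i) = b (i mod m)

IsHomG : (H : FinGraph) → (GV → Fin (n H)) → Set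
IsHomG H f = ∀ x y → GEdge x y → Adj H (f x) (f y)

IsEmbeddingD : (m : ℕ) .{{_ : NonZero m}} (H : FinGraph) → (DV m → Fin (n H)) → Set
IsEmbeddingD m H g =
  (∀ x y → g x ≡ g y → x ≡ y) × (∀ x y → DEdge m x y ⇔ Adj H (g x) (g y))

{-# OPTIONS --safe #-}

-- Write x, y, α i, β i for the images of v₁, v₂, a i, b i.  Excluding K4 already rules out
-- the short coincidences and extra edges around each triangle (x ≁ β i, α i ≁ α (2 + i),
-- α (2 + i) ≢ α i, …); every remaining way in which f could fail to factor through an
-- embedding of some D_d is refuted by exhibiting the five branch sets of a K5 minor.
-- Since H is finite, α repeats, and these constraints force its first repetition to be
-- α d ≡ α 0 with d ≥ 4; then α (d + i) ≡ α i for all i, by induction along the shift of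
-- G∞.  The same argument after the half-shift a i ↦ b i ↦ a (1 + i) gives β the same
-- period, and the only adjacencies among x, y, α and β are the images of edges of D_d.
module Submission where

open import Defs hiding (sym)
open import Data.Bool using (Bool; true)
open import Data.Empty using (⊥; ⊥-elim)
open import Data.Fin using (Fin; zero; suc; toℕ)
import Data.Fin.Properties as Fin
open import Data.List using (List; []; _∷_; applyUpTo)
open import Data.List.Membership.Propositional using (_∈_)
open import Data.List.Membership.Propositional.Properties using (∈-applyUpTo⁺)
open import Data.List.Relation.Unary.All as All using (All; []; _∷_)
open import Data.List.Relation.Unary.All.Properties using (All-swap; applyUpTo⁺₁)
open import Data.List.Relation.Unary.Any using (here; there)
open import Data.Nat using (ℕ; zero; suc; _+_; _*_; _∸_; _≤_; _<_; _≤?_; s≤s; s≤s⁻¹; z<s; s<s; NonZero)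
open import Data.Nat.DivMod using (_%_; _/_; _mod_; m≡m%n+[m/n]*n)
open import Data.Nat.Properties
open import Algebra.Properties.CommutativeSemigroup +-commutativeSemigroup using (x∙yz≈y∙xz)
open import Data.Product using (Σ; ∃; ∃₂; _×_; _,_; proj₁; proj₂)
open import Data.Sum using (_⊎_; inj₁; inj₂; swap)
open import Data.Vec using (Vec; []; _∷_; lookup)
open import Data.Vec.Relation.Unary.All as VAll using ([]; _∷_)
open import Data.Vec.Relation.Unary.All.Properties as VAll using ()
open import Data.Vec.Relation.Unary.AllPairs using (AllPairs; []; _∷_)
open import Function using (_∘_; mk⇔)
open import Level using (0ℓ)
open import Relation.Binary.Core using (Rel)
open import Relation.Binary.Definitions using (Symmetric; DecidableEquality; tri<; tri≈; tri>)
open import Relation.Binary.PropositionalEquality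
  using (_≡_; _≢_; refl; sym; trans; cong; subst; subst₂; ≢-sym; module ≡-Reasoning)
open import Relation.Nullary using (¬_; yes; no; does)
open import Relation.Nullary.Decidable using (dec-true)

lookup-AllPairs : ∀ {A : Set} {R : Rel A 0ℓ} → Symmetric R →
                  ∀ {n} {xs : Vec A n} → AllPairs R xs →
                  ∀ {i j} → i ≢ j → R (lookup xs i) (lookup xs j)
lookup-AllPairs R-sym (_ ∷ _)      {zero}  {zero}  i≢j = ⊥-elim (i≢j refl)
lookup-AllPairs R-sym (Rx ∷ _)     {zero}  {suc j} _   = VAll.lookup⁺ Rx j
lookup-AllPairs R-sym (Rx ∷ _)     {suc i} {zero}  _   = R-sym (VAll.lookup⁺ Rx i)
lookup-AllPairs R-sym (_ ∷ Rxs)    {suc i} {suc j} i≢j =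
  lookup-AllPairs R-sym Rxs (i≢j ∘ cong suc)

module Graph (H : FinGraph) where

  V : Set
  V = Fin (n H)

  open import Data.List.Membership.DecPropositional (Fin._≟_ {n H}) using (_∈?_)

  infix 4 _~_
  _~_ : V → V → Set
  _~_ = Adj H

  ~-sym : Symmetric _~_
  ~-sym {u} {v} = trans (FinGraph.sym H v u)

  ~-irrefl : ∀ {u v} → u ~ v → u ≢ v
  ~-irrefl {u} u~u refl with () ← trans (sym (FinGraph.irrefl H u)) u~u

  module _ {S : V → Set} where

    _++ʷ_ : ∀ {u v w} → WalkIn H S u v → WalkIn H S v w → WalkIn H S u w
    here       ++ʷ q = q
    step e s p ++ʷ q = step e s (p ++ʷ q)

    mapʷ : ∀ {T : V → Set} → (∀ {z} → S z → T z) → ∀ {u v} → WalkIn H S u v → WalkIn H T u v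
    mapʷ S⇒T here         = here
    mapʷ S⇒T (step e s p) = step e (S⇒T s) (mapʷ S⇒T p)

  data Connected : List V → Set where
    [_]    : ∀ v → Connected (v ∷ [])
    attach : ∀ {L w u} → Connected L → u ∈ L → w ~ u → Connected (w ∷ L)

  connected-walk : ∀ {L u v} → Connected L → u ∈ L → v ∈ L → WalkIn H (_∈ L) u v
  connected-walk [ _ ]            (here refl) (here refl) = here
  connected-walk (attach _ _ _)   (here refl) (here refl) = here
  connected-walk (attach c u∈ e)  (here refl) (there v∈) =
    step e (there u∈) (mapʷ there (connected-walk c u∈ v∈))
  connected-walk (attach c u∈ e)  (there w∈) (here refl) =
    mapʷ there (connected-walk c w∈ u∈) ++ʷ step (~-sym e) (here refl) here
  connected-walk (attach c _ _)   (there p)  (there q) = mapʷ there (connected-walk c p q)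

  Connected-nonempty : ∀ {L} → Connected L → ∃ (_∈ L)
  Connected-nonempty [ v ]                = v , here refl
  Connected-nonempty (attach {w = w} _ _ _) = w , here refl

  path-connected : (g : ℕ → V) → (∀ i → g i ~ g (suc i)) → ∀ len → Connected (applyUpTo g (suc len))
  path-connected g g~ zero      = [ g 0 ]
  path-connected g g~ (suc len) =
    attach (path-connected (g ∘ suc) (g~ ∘ suc) len) (here refl) (g~ 0)

  Apart : List V → List V → Set
  Apart L M = All (λ u → All (u ≢_) M) L

  Apart-sym : Symmetric Apart
  Apart-sym = All.map (All.map ≢-sym) ∘ All-swap

  Touching : List V → List V → Set
  Touching L M = ∃₂ λ u w → u ∈ L × w ∈ M × u ~ w

  touch : ∀ {L M u w} → u ∈ L → w ∈ M → u ~ w → Touching L M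
  touch u∈ w∈ e = _ , _ , u∈ , w∈ , e

  heads : ∀ {L M u w} → u ~ w → Touching (u ∷ L) (w ∷ M)
  heads = touch (here refl) (here refl)

  Touching-sym : Symmetric Touching
  Touching-sym (u , w , u∈ , w∈ , e) = w , u , w∈ , u∈ , ~-sym e

  K4-clique : (vs : Vec V 4) → AllPairs _~_ vs → HasK4Subgraph H
  K4-clique vs clique = lookup vs , injective , adjacent
    where
    adjacent : ∀ i j → i ≢ j → lookup vs i ~ lookup vs j
    adjacent i j = lookup-AllPairs ~-sym clique
    injective : ∀ i j → lookup vs i ≡ lookup vs j → i ≡ j
    injective i j eq with i Fin.≟ j
    ... | yes i≡j = i≡j
    ... | no  i≢j = ⊥-elim (~-irrefl (adjacent i j i≢j) eq)

  K5-minor : (Ls : Vec (List V) 5) → VAll.All Connected Ls →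
             AllPairs Apart Ls → AllPairs Touching Ls → HasK5Minor H
  K5-minor Ls connected apart touching = B , disjoint , nonempty , walks , edges
    where
    B : Fin 5 → V → Bool
    B i v = does (v ∈? lookup Ls i)
    ∈-sound : ∀ {i v} → B i v ≡ true → v ∈ lookup Ls i
    ∈-sound {i} {v} p with v ∈? lookup Ls i | p
    ... | yes v∈ | _ = v∈
    ∈-complete : ∀ {i v} → v ∈ lookup Ls i → B i v ≡ true
    ∈-complete {i} {v} = dec-true (v ∈? lookup Ls i)
    disjoint : ∀ i j v → B i v ≡ true → B j v ≡ true → i ≡ j
    disjoint i j v p q with i Fin.≟ j
    ... | yes i≡j = i≡j
    ... | no  i≢j = ⊥-elim (All.lookup (All.lookup (lookup-AllPairs Apart-sym apart i≢j) (∈-sound p))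
                                       (∈-sound q) refl)
    nonempty : ∀ i → ∃ λ v → B i v ≡ true
    nonempty i with Connected-nonempty (VAll.lookup⁺ connected i)
    ... | v , v∈ = v , ∈-complete v∈
    walks : ∀ i u v → B i u ≡ true → B i v ≡ true → WalkIn H (λ w → B i w ≡ true) u v
    walks i u v p q = mapʷ ∈-complete (connected-walk (VAll.lookup⁺ connected i) (∈-sound p) (∈-sound q))
    edges : ∀ i j → i ≢ j → Σ V λ u → Σ V λ v → B i u ≡ true × B j v ≡ true × u ~ v
    edges i j i≢j with lookup-AllPairs Touching-sym touching i≢j
    ... | u , w , u∈ , w∈ , e = u , w , ∈-complete u∈ , ∈-complete w∈ , e

module _ {A : Set} where

  InjectiveBelow : (ℕ → A) → ℕ → Set
  InjectiveBelow g m = ∀ {i j} → i < m → j < m → g i ≡ g j → i ≡ j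

  Cycle : (ℕ → A) → ℕ → Set
  Cycle g d = InjectiveBelow g d × g d ≡ g 0

  ExactPeriod : (ℕ → A) → ℕ → Set
  ExactPeriod g d = ∀ t → Cycle (λ i → g (i + t)) d

  FirstRepetition : (ℕ → A) → Set
  FirstRepetition g = ∃₂ λ s k → s < k × g k ≡ g s × InjectiveBelow g k

  InjectiveBelow-resp : ∀ {g h : ℕ → A} {m} → (∀ i → g i ≡ h i) → InjectiveBelow g m → InjectiveBelow h m
  InjectiveBelow-resp g≗h inj i<m j<m eq = inj i<m j<m (trans (g≗h _) (trans eq (sym (g≗h _))))

  Cycle-resp : ∀ {g h : ℕ → A} {d} → (∀ i → g i ≡ h i) → Cycle g d → Cycle h d
  Cycle-resp g≗h (inj , closed) = InjectiveBelow-resp g≗h inj , trans (sym (g≗h _)) (trans closed (g≗h 0))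

  module _ {g : ℕ → A} where

    distinct-below : ∀ {m i j} → InjectiveBelow g m → i < m → j < m → i ≢ j → g i ≢ g j
    distinct-below inj i<m j<m i≢j = i≢j ∘ inj i<m j<m

    InjectiveBelow-mono : ∀ {m m′} → m′ ≤ m → InjectiveBelow g m → InjectiveBelow g m′
    InjectiveBelow-mono m′≤m inj i<m′ j<m′ = inj (<-≤-trans i<m′ m′≤m) (<-≤-trans j<m′ m′≤m)

    InjectiveBelow-extend : ∀ {m} → InjectiveBelow g m → (∀ {i} → i < m → g m ≢ g i) →
                            InjectiveBelow g (suc m)
    InjectiveBelow-extend inj new {i} {j} (s≤s i≤m) (s≤s j≤m) eq
      with m≤n⇒m<n∨m≡n i≤m | m≤n⇒m<n∨m≡n j≤m
    ... | inj₁ i<m  | inj₁ j<m  = inj i<m j<m eq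
    ... | inj₁ i<m  | inj₂ refl = ⊥-elim (new i<m (sym eq))
    ... | inj₂ refl | inj₁ j<m  = ⊥-elim (new j<m eq)
    ... | inj₂ i≡m  | inj₂ j≡m  = trans i≡m (sym j≡m)

    InjectiveBelow-window : ∀ t {m} → InjectiveBelow g (m + t) → InjectiveBelow (λ i → g (i + t)) m
    InjectiveBelow-window t inj i<m j<m eq = +-cancelʳ-≡ t _ _ (inj (+-monoˡ-< t i<m) (+-monoˡ-< t j<m) eq)

    InjectiveBelow-Fin : ∀ {d} → InjectiveBelow g d → ∀ {i j : Fin d} → g (toℕ i) ≡ g (toℕ j) → i ≡ j
    InjectiveBelow-Fin inj {i} {j} = Fin.toℕ-injective ∘ inj (Fin.toℕ<n i) (Fin.toℕ<n j)

    Cycle-suc : ∀ {d} → Cycle g d → g (suc d) ≡ g 1 → Cycle (g ∘ suc) d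
    Cycle-suc {d} (inj , closed) returns = inj′ , returns
      where
      inj′ : InjectiveBelow (g ∘ suc) d
      inj′ {i} {j} i<d j<d eq with m≤n⇒m<n∨m≡n i<d | m≤n⇒m<n∨m≡n j<d
      ... | inj₁ 1+i<d | inj₁ 1+j<d = suc-injective (inj 1+i<d 1+j<d eq)
      ... | inj₁ 1+i<d | inj₂ refl with () ← inj 1+i<d (<-≤-trans z<s j<d) (trans eq closed)
      ... | inj₂ refl | inj₁ 1+j<d with () ← inj 1+j<d (<-≤-trans z<s i<d) (trans (sym eq) closed)
      ... | inj₂ 1+i≡d | inj₂ 1+j≡d = suc-injective (trans 1+i≡d (sym 1+j≡d))

    period : ∀ {d} → ExactPeriod g d → ∀ t → g (d + t) ≡ g t
    period P t = proj₂ (P t)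

    ExactPeriod⇒Cycle : ∀ {d} → ExactPeriod g d → Cycle g d
    ExactPeriod⇒Cycle P = Cycle-resp (λ i → cong g (+-identityʳ i)) (P 0)

    period-multiple : ∀ {d} → ExactPeriod g d → ∀ r q → g (r + q * d) ≡ g r
    period-multiple P r zero    = cong g (+-identityʳ r)
    period-multiple {d} P r (suc q) = begin
      g (r + (d + q * d))  ≡⟨ cong g (x∙yz≈y∙xz r d (q * d)) ⟩
      g (d + (r + q * d))  ≡⟨ period P (r + q * d) ⟩
      g (r + q * d)        ≡⟨ period-multiple P r q ⟩
      g r                  ∎
      where open ≡-Reasoning

    period-mod : ∀ {d} .{{_ : NonZero d}} → ExactPeriod g d → ∀ k → g (toℕ (k mod d)) ≡ g k
    period-mod {d} P k = begin
      g (toℕ (k mod d))        ≡⟨ cong g (Fin.toℕ-fromℕ< _) ⟩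
      g (k % d)                ≡⟨ period-multiple P (k % d) (k / d) ⟨
      g (k % d + (k / d) * d)  ≡⟨ cong g (m≡m%n+[m/n]*n k d) ⟨
      g k                      ∎
      where open ≡-Reasoning

    -- j ≡ k + i modulo d, in a form usable at j and at suc j alike.
    period-offset : ∀ {d i j} → ExactPeriod g d → i < d → j < d →
                    ∃ λ k → k < d × (∀ s → g (s + (k + i)) ≡ g (s + j))
    period-offset {d} {i} {j} P i<d j<d with i ≤? j
    ... | yes i≤j = j ∸ i , ≤-<-trans (m∸n≤m j i) j<d , λ s → cong (λ m → g (s + m)) (m∸n+n≡m i≤j)
    ... | no  i≰j = (d + j) ∸ i , k<d , λ s → begin
          g (s + ((d + j) ∸ i + i))  ≡⟨ cong (λ m → g (s + m)) k+i≡d+j ⟩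
          g (s + (d + j))            ≡⟨ cong g (x∙yz≈y∙xz s d j) ⟩
          g (d + (s + j))            ≡⟨ period P (s + j) ⟩
          g (s + j)                  ∎
      where
      open ≡-Reasoning
      k+i≡d+j : (d + j) ∸ i + i ≡ d + j
      k+i≡d+j = m∸n+n≡m (≤-trans (<⇒≤ i<d) (m≤m+n d j))
      k<d : (d + j) ∸ i < d
      k<d = +-cancelʳ-< i _ d (subst (_< d + i) (sym k+i≡d+j) (+-monoʳ-< d (≰⇒> i≰j)))

  injective-or-repetition : DecidableEquality A → ∀ g K → InjectiveBelow g K ⊎ FirstRepetition g
  injective-or-repetition _≟_ g zero    = inj₁ (λ ())
  injective-or-repetition _≟_ g (suc K) with injective-or-repetition _≟_ g K
  ... | inj₂ rep = inj₂ rep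
  ... | inj₁ inj with anyUpTo? (λ i → g K ≟ g i) K
  ...   | yes (s , s<K , eq) = inj₂ (s , K , s<K , eq , inj)
  ...   | no  new            = inj₁ (InjectiveBelow-extend inj λ i<K eq → new (_ , i<K , eq))

first-repetition : ∀ {m} (g : ℕ → Fin m) → FirstRepetition g
first-repetition {m} g with injective-or-repetition Fin._≟_ g (suc m)
... | inj₂ rep = rep
... | inj₁ inj = let i , j , i<j , eq = Fin.pigeonhole (n<1+n m) (g ∘ toℕ) in
                 ⊥-elim (<-irrefl (inj (Fin.toℕ<n i) (Fin.toℕ<n j) eq) i<j)

IsEndo : (GV → GV) → Set
IsEndo φ = ∀ {u v} → GArc u v → GEdge (φ u) (φ v)

shift : ℕ → GV → GV
shift t v₁    = v₁
shift t v₂    = v₂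
shift t (a i) = a (i + t)
shift t (b i) = b (i + t)

shift-endo : ∀ t → IsEndo (shift t)
shift-endo t (v₁a i) = inj₁ (v₁a (i + t))
shift-endo t (v₂b i) = inj₁ (v₂b (i + t))
shift-endo t (ab i)  = inj₁ (ab (i + t))
shift-endo t (aa i)  = inj₁ (aa (i + t))
shift-endo t (bb i)  = inj₁ (bb (i + t))
shift-endo t (a'b i) = inj₁ (a'b (i + t))

halfShift : GV → GV
halfShift v₁    = v₂
halfShift v₂    = v₁
halfShift (a i) = b i
halfShift (b i) = a (suc i)

halfShift-endo : IsEndo halfShift
halfShift-endo (v₁a i) = inj₁ (v₂b i)
halfShift-endo (v₂b i) = inj₁ (v₁a (suc i))
halfShift-endo (ab i)  = inj₂ (a'b i)
halfShift-endo (aa i)  = inj₁ (bb i)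
halfShift-endo (bb i)  = inj₁ (aa (suc i))
halfShift-endo (a'b i) = inj₂ (ab (suc i))

module _ {H : FinGraph} (K4-free : ¬ HasK4Subgraph H) (K5-minor-free : ¬ HasK5Minor H) where

  open Graph H

  IsHomG-∘ : ∀ {f φ} → IsEndo φ → IsHomG H f → IsHomG H (f ∘ φ)
  IsHomG-∘ φ-endo hom _ _ (inj₁ uv) = hom _ _ (φ-endo uv)
  IsHomG-∘ φ-endo hom _ _ (inj₂ vu) = hom _ _ (swap (φ-endo vu))

  module Image (f : GV → V) (hom : IsHomG H f) where

    x y : V
    x = f v₁
    y = f v₂

    α β : ℕ → V
    α i = f (a i)
    β i = f (b i)

    xα : ∀ i → x ~ α i
    xα i = hom _ _ (inj₁ (v₁a i))

    yβ : ∀ i → y ~ β i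
    yβ i = hom _ _ (inj₁ (v₂b i))

    αβ : ∀ i → α i ~ β i
    αβ i = hom _ _ (inj₁ (ab i))

    αα : ∀ i → α i ~ α (suc i)
    αα i = hom _ _ (inj₁ (aa i))

    ββ : ∀ i → β i ~ β (suc i)
    ββ i = hom _ _ (inj₁ (bb i))

    α'β : ∀ i → α (suc i) ~ β i
    α'β i = hom _ _ (inj₁ (a'b i))

    x≁β : ∀ i → ¬ x ~ β i
    x≁β i x~β = K4-free (K4-clique (x ∷ α i ∷ α (suc i) ∷ β i ∷ [])
      ((xα i ∷ xα (suc i) ∷ x~β ∷ []) ∷ (αα i ∷ αβ i ∷ []) ∷ (α'β i ∷ []) ∷ [] ∷ []))

    βᵢ₊₁≁αᵢ : ∀ i → ¬ β (suc i) ~ α i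
    βᵢ₊₁≁αᵢ i β~α = K4-free (K4-clique (α i ∷ α (suc i) ∷ β i ∷ β (suc i) ∷ [])
      ((αα i ∷ αβ i ∷ ~-sym β~α ∷ []) ∷ (α'β i ∷ αβ (suc i) ∷ []) ∷ (ββ i ∷ []) ∷ [] ∷ []))

    αᵢ≁αᵢ₊₂ : ∀ i → ¬ α i ~ α (2 + i)
    αᵢ≁αᵢ₊₂ i α~α = K4-free (K4-clique (x ∷ α i ∷ α (1 + i) ∷ α (2 + i) ∷ [])
      ((xα i ∷ xα (1 + i) ∷ xα (2 + i) ∷ []) ∷ (αα i ∷ α~α ∷ []) ∷ (αα (1 + i) ∷ []) ∷ [] ∷ []))

    αᵢ₊₂≢αᵢ : ∀ i → α (2 + i) ≢ α i
    αᵢ₊₂≢αᵢ i eq = βᵢ₊₁≁αᵢ i (subst (β (suc i) ~_) eq (~-sym (α'β (suc i))))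

    αᵢ₊₃≢αᵢ : ∀ i → α (3 + i) ≢ α i
    αᵢ₊₃≢αᵢ i eq = αᵢ≁αᵢ₊₂ i (~-sym (subst (α (2 + i) ~_) eq (αα (2 + i))))

    x≢α : ∀ i → x ≢ α i
    x≢α i = ~-irrefl (xα i)

    y≢β : ∀ i → y ≢ β i
    y≢β i = ~-irrefl (yβ i)

    x≢β : ∀ i → x ≢ β i
    x≢β i eq = x≁β (suc i) (subst (_~ β (suc i)) (sym eq) (ββ i))

    x≢y : x ≢ y
    x≢y eq = x≁β 0 (subst (_~ β 0) (sym eq) (yβ 0))

    α≢β : ∀ i j → α i ≢ β j
    α≢β i j eq = x≁β j (subst (x ~_) eq (xα i))

    α₀≢α₁ : α 0 ≢ α 1
    α₀≢α₁ = ~-irrefl (αα 0)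

    cycle-closing-edge : ∀ {e} → α (4 + e) ≡ α 0 → α 0 ~ α (3 + e)
    cycle-closing-edge {e} closed = ~-sym (subst (α (3 + e) ~_) closed (αα (3 + e)))

  module Minors (f : GV → V) (hom : IsHomG H f) where

    open Image f hom public
    -- Turned.x, Turned.y, Turned.α, Turned.β are y, x, β, α ∘ suc.
    private module Turned = Image (f ∘ halfShift) (IsHomG-∘ halfShift-endo hom)

    y≁αᵢ₊₁ : ∀ i → ¬ y ~ α (suc i)
    y≁αᵢ₊₁ = Turned.x≁β

    y≢α : ∀ i → y ≢ α i
    y≢α zero    eq = Turned.x≁β 0 (subst (_~ α 1) (sym eq) (αα 0))
    y≢α (suc i)    = Turned.x≢β i

    α≢y : ∀ i → α i ≢ y
    α≢y i = ≢-sym (y≢α i)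

    β₀≢β₂ : β 0 ≢ β 2
    β₀≢β₂ = ≢-sym (Turned.αᵢ₊₂≢αᵢ 0)

    segment : ℕ → ℕ → List V
    segment lo len = applyUpTo (λ i → α (lo + i)) len

    segment-connected : ∀ lo len → Connected (segment lo (suc len))
    segment-connected lo = path-connected (λ i → α (lo + i))
      (λ i → subst (α (lo + i) ~_) (cong α (sym (+-suc lo i))) (αα (lo + i)))

    segment⁺ : ∀ {P : V → Set} lo len → (∀ {i} → i < len → P (α (lo + i))) → All P (segment lo len)
    segment⁺ lo len = applyUpTo⁺₁ _ len

    segment-head : ∀ lo len → α lo ∈ segment lo (suc len)
    segment-head lo len = subst (_∈ segment lo (suc len)) (cong α (+-identityʳ lo)) (here refl)

    segment-last : ∀ lo len → α (lo + len) ∈ segment lo (suc len)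
    segment-last lo len = ∈-applyUpTo⁺ (λ i → α (lo + i)) ≤-refl

    no-exit : ∀ {e} → Cycle α (4 + e) → ¬ (∀ {i} → i < 4 + e → α (5 + e) ≢ α i)
    no-exit {e} (inj , closed) new = K5-minor-free (K5-minor branches connected apart touching)
      where
      branches : Vec (List V) 5
      branches = (x ∷ []) ∷ (α 0 ∷ []) ∷ (α 1 ∷ []) ∷ segment 2 (2 + e)
               ∷ (α (5 + e) ∷ β (4 + e) ∷ β 1 ∷ y ∷ []) ∷ []
      connected : VAll.All Connected branches
      connected = [ x ] ∷ [ α 0 ] ∷ [ α 1 ] ∷ segment-connected 2 (1 + e)
                ∷ attach (attach (attach [ y ] (here refl) (~-sym (yβ 1)))
                                 (there (here refl)) (~-sym (yβ _)))
                         (here refl) (α'β _)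
                ∷ []
      apart : AllPairs Apart branches
      apart =
          (((x≢α 0 ∷ []) ∷ []) ∷ ((x≢α 1 ∷ []) ∷ []) ∷ (segment⁺ 2 (2 + e) (λ _ → x≢α _) ∷ [])
          ∷ ((x≢α _ ∷ x≢β _ ∷ x≢β 1 ∷ x≢y ∷ []) ∷ []) ∷ [])
        ∷ (((α₀≢α₁ ∷ []) ∷ [])
          ∷ (segment⁺ 2 (2 + e) (λ i< → distinct-below inj z<s (s<s (s<s i<)) λ ()) ∷ [])
          ∷ ((≢-sym (new z<s) ∷ α≢β 0 _ ∷ α≢β 0 1 ∷ α≢y 0 ∷ []) ∷ []) ∷ [])
        ∷ ((segment⁺ 2 (2 + e) (λ i< → distinct-below inj (s<s z<s) (s<s (s<s i<)) λ ()) ∷ [])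
          ∷ ((≢-sym (new (s<s z<s)) ∷ α≢β 1 _ ∷ α≢β 1 1 ∷ α≢y 1 ∷ []) ∷ []) ∷ [])
        ∷ (segment⁺ 2 (2 + e) (λ i< → ≢-sym (new (s<s (s<s i<))) ∷ α≢β _ _ ∷ α≢β _ 1 ∷ α≢y _ ∷ [])
          ∷ [])
        ∷ [] ∷ []
      touching : AllPairs Touching branches
      touching =
          (heads (xα 0) ∷ heads (xα 1) ∷ heads (xα 2) ∷ heads (xα _) ∷ [])
        ∷ (heads (αα 0)
          ∷ touch (here refl) (segment-last 2 (1 + e)) (cycle-closing-edge closed)
          ∷ touch (here refl) (there (here refl)) (subst (_~ β (4 + e)) closed (αβ (4 + e))) ∷ [])
        ∷ (heads (αα 1) ∷ touch (here refl) (there (there (here refl))) (αβ 1) ∷ [])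
        ∷ (touch (here refl) (there (there (here refl))) (α'β 1) ∷ [])
        ∷ [] ∷ []

    no-chord : ∀ {e p} → Cycle α (4 + e) → p ≤ e → ¬ α 0 ~ α (2 + p)
    no-chord {p = p} (inj , closed) p≤e chord with m≤n⇒∃[o]m+o≡n p≤e
    ... | r , refl = K5-minor-free (K5-minor branches connected apart touching)
      where
      2+p<d : 2 + p < 4 + (p + r)
      2+p<d = s<s (s<s (s<s (m≤n⇒m≤1+n (m≤m+n p r))))
      low : ∀ {i} → i < 1 + p → 1 + i < 4 + (p + r)
      low i< = <-trans (s<s i<) 2+p<d
      high : ∀ {i} → i < 1 + r → (3 + p) + i < 4 + (p + r)
      high i< = s<s (s<s (s<s (s<s (+-monoʳ-≤ p (s≤s⁻¹ i<)))))
      low<high : ∀ {i j} → i < 1 + p → 1 + i < (3 + p) + j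
      low<high {j = j} i< = ≤-trans (s≤s i<) (s≤s (s≤s (m≤n⇒m≤1+n (m≤m+n p j))))
      branches : Vec (List V) 5
      branches = (x ∷ []) ∷ (α 0 ∷ []) ∷ (α (2 + p) ∷ []) ∷ segment 1 (1 + p)
               ∷ (β (1 + p) ∷ β (2 + p) ∷ segment (3 + p) (1 + r)) ∷ []
      connected : VAll.All Connected branches
      connected = [ x ] ∷ [ α 0 ] ∷ [ α (2 + p) ] ∷ segment-connected 1 p
                ∷ attach (attach (segment-connected (3 + p) r) (segment-head (3 + p) r) (~-sym (α'β (2 + p))))
                         (here refl) (ββ (1 + p))
                ∷ []
      apart : AllPairs Apart branches
      apart =
          (((x≢α 0 ∷ []) ∷ []) ∷ ((x≢α _ ∷ []) ∷ []) ∷ (segment⁺ 1 (1 + p) (λ _ → x≢α _) ∷ [])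
          ∷ ((x≢β _ ∷ x≢β _ ∷ segment⁺ (3 + p) (1 + r) (λ _ → x≢α _)) ∷ []) ∷ [])
        ∷ (((distinct-below inj z<s 2+p<d (λ ()) ∷ []) ∷ [])
          ∷ (segment⁺ 1 (1 + p) (λ i< → distinct-below inj z<s (low i<) λ ()) ∷ [])
          ∷ ((α≢β 0 _ ∷ α≢β 0 _ ∷ segment⁺ (3 + p) (1 + r) (λ i< → distinct-below inj z<s (high i<) λ ()))
            ∷ [])
          ∷ [])
        ∷ ((segment⁺ 1 (1 + p) (λ i< → distinct-below inj 2+p<d (low i<) (>⇒≢ (s<s i<))) ∷ [])
          ∷ ((α≢β _ _ ∷ α≢β _ _ ∷ segment⁺ (3 + p) (1 + r) λ {i} i< →
                distinct-below inj 2+p<d (high i<) (<⇒≢ (s<s (s<s (s<s (m≤m+n p i))))))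
            ∷ [])
          ∷ [])
        ∷ (segment⁺ 1 (1 + p) (λ i< → α≢β _ _ ∷ α≢β _ _ ∷ segment⁺ (3 + p) (1 + r) λ j< →
             distinct-below inj (low i<) (high j<) (<⇒≢ (low<high i<)))
          ∷ [])
        ∷ [] ∷ []
      touching : AllPairs Touching branches
      touching =
          (heads (xα 0) ∷ heads (xα _) ∷ heads (xα 1)
          ∷ touch (here refl) (there (there (segment-last (3 + p) r))) (xα _) ∷ [])
        ∷ (heads chord ∷ heads (αα 0)
          ∷ touch (here refl) (there (there (segment-last (3 + p) r))) (cycle-closing-edge closed) ∷ [])
        ∷ (touch (here refl) (segment-last 1 p) (~-sym (αα (1 + p)))
          ∷ touch (here refl) (there (here refl)) (αβ _) ∷ [])
        ∷ (touch (segment-last 1 p) (here refl) (αβ (1 + p)) ∷ [])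
        ∷ [] ∷ []

    no-entry : ∀ {e} → InjectiveBelow α (5 + e) → α (5 + e) ≢ α 1
    no-entry {e} inj returns = K5-minor-free (K5-minor branches connected apart touching)
      where
      d<d+1 : 4 + e < 5 + e
      d<d+1 = n<1+n _
      middle : ∀ {i} → i < 2 + e → 2 + i < 5 + e
      middle i< = m<n⇒m<1+n (s<s (s<s i<))
      branches : Vec (List V) 5
      branches = (x ∷ []) ∷ (α 1 ∷ []) ∷ (α (4 + e) ∷ []) ∷ segment 2 (2 + e)
               ∷ (α 0 ∷ β 0 ∷ β (3 + e) ∷ y ∷ []) ∷ []
      connected : VAll.All Connected branches
      connected = [ x ] ∷ [ α 1 ] ∷ [ α (4 + e) ] ∷ segment-connected 2 (1 + e)
                ∷ attach (attach (attach [ y ] (here refl) (~-sym (yβ (3 + e))))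
                                 (there (here refl)) (~-sym (yβ 0)))
                         (here refl) (αβ 0)
                ∷ []
      apart : AllPairs Apart branches
      apart =
          (((x≢α 1 ∷ []) ∷ []) ∷ ((x≢α _ ∷ []) ∷ []) ∷ (segment⁺ 2 (2 + e) (λ _ → x≢α _) ∷ [])
          ∷ ((x≢α 0 ∷ x≢β 0 ∷ x≢β _ ∷ x≢y ∷ []) ∷ []) ∷ [])
        ∷ (((distinct-below inj (s<s z<s) d<d+1 (λ ()) ∷ []) ∷ [])
          ∷ (segment⁺ 2 (2 + e) (λ i< → distinct-below inj (s<s z<s) (middle i<) λ ()) ∷ [])
          ∷ ((≢-sym α₀≢α₁ ∷ α≢β 1 0 ∷ α≢β 1 _ ∷ α≢y 1 ∷ []) ∷ []) ∷ [])
        ∷ ((segment⁺ 2 (2 + e) (λ i< → distinct-below inj d<d+1 (middle i<) (>⇒≢ (s<s (s<s i<)))) ∷ [])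
          ∷ ((distinct-below inj d<d+1 z<s (λ ()) ∷ α≢β _ 0 ∷ α≢β _ _ ∷ α≢y _ ∷ []) ∷ []) ∷ [])
        ∷ (segment⁺ 2 (2 + e) (λ i< →
             distinct-below inj (middle i<) z<s (λ ()) ∷ α≢β _ 0 ∷ α≢β _ _ ∷ α≢y _ ∷ [])
          ∷ [])
        ∷ [] ∷ []
      touching : AllPairs Touching branches
      touching =
          (heads (xα 1) ∷ heads (xα _) ∷ heads (xα 2) ∷ heads (xα 0) ∷ [])
        ∷ (heads (~-sym (subst (α (4 + e) ~_) returns (αα (4 + e))))
          ∷ heads (αα 1) ∷ touch (here refl) (there (here refl)) (α'β 0) ∷ [])
        ∷ (touch (here refl) (segment-last 2 (1 + e)) (~-sym (αα (3 + e)))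
          ∷ touch (here refl) (there (there (here refl))) (α'β (3 + e)) ∷ [])
        ∷ (touch (segment-last 2 (1 + e)) (there (there (here refl))) (αβ (3 + e)) ∷ [])
        ∷ [] ∷ []

    no-period-mismatch : ∀ {e} → Cycle α (4 + e) → α (5 + e) ≡ α 1 → ¬ InjectiveBelow β (5 + e)
    no-period-mismatch {e} (inj , closed) returns injβ =
      K5-minor-free (K5-minor branches connected apart touching)
      where
      3+e<5+e : 3 + e < 5 + e
      3+e<5+e = m<n⇒m<1+n (n<1+n _)
      branches : Vec (List V) 5
      branches = (α 0 ∷ []) ∷ (α 1 ∷ []) ∷ (x ∷ segment 2 (2 + e)) ∷ (β 1 ∷ β 0 ∷ [])
               ∷ (β (3 + e) ∷ β (4 + e) ∷ y ∷ []) ∷ []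
      connected : VAll.All Connected branches
      connected = [ α 0 ] ∷ [ α 1 ] ∷ attach (segment-connected 2 (1 + e)) (here refl) (xα 2)
                ∷ attach [ β 0 ] (here refl) (~-sym (ββ 0))
                ∷ attach (attach [ y ] (here refl) (~-sym (yβ (4 + e)))) (here refl) (ββ (3 + e))
                ∷ []
      apart : AllPairs Apart branches
      apart =
          (((α₀≢α₁ ∷ []) ∷ [])
          ∷ ((≢-sym (x≢α 0) ∷ segment⁺ 2 (2 + e) (λ i< → distinct-below inj z<s (s<s (s<s i<)) λ ())) ∷ [])
          ∷ ((α≢β 0 1 ∷ α≢β 0 0 ∷ []) ∷ [])
          ∷ ((α≢β 0 _ ∷ α≢β 0 _ ∷ α≢y 0 ∷ []) ∷ []) ∷ [])
        ∷ (((≢-sym (x≢α 1) ∷ segment⁺ 2 (2 + e) (λ i< → distinct-below inj (s<s z<s) (s<s (s<s i<)) λ ()))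
            ∷ [])
          ∷ ((α≢β 1 1 ∷ α≢β 1 0 ∷ []) ∷ [])
          ∷ ((α≢β 1 _ ∷ α≢β 1 _ ∷ α≢y 1 ∷ []) ∷ []) ∷ [])
        ∷ (((x≢β 1 ∷ x≢β 0 ∷ []) ∷ segment⁺ 2 (2 + e) (λ _ → α≢β _ 1 ∷ α≢β _ 0 ∷ []))
          ∷ ((x≢β _ ∷ x≢β _ ∷ x≢y ∷ []) ∷ segment⁺ 2 (2 + e) (λ _ → α≢β _ _ ∷ α≢β _ _ ∷ α≢y _ ∷ []))
          ∷ [])
        ∷ (((distinct-below injβ (s<s z<s) 3+e<5+e (λ ()) ∷ distinct-below injβ (s<s z<s) (n<1+n _) (λ ())
             ∷ ≢-sym (y≢β 1) ∷ [])
          ∷ (distinct-below injβ z<s 3+e<5+e (λ ()) ∷ distinct-below injβ z<s (n<1+n _) (λ ())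
             ∷ ≢-sym (y≢β 0) ∷ [])
          ∷ [])
          ∷ [])
        ∷ [] ∷ []
      touching : AllPairs Touching branches
      touching =
          (heads (αα 0) ∷ heads (~-sym (xα 0)) ∷ touch (here refl) (there (here refl)) (αβ 0)
          ∷ touch (here refl) (there (here refl)) (subst (_~ β (4 + e)) closed (αβ (4 + e))) ∷ [])
        ∷ (heads (~-sym (xα 1)) ∷ touch (here refl) (there (here refl)) (α'β 0)
          ∷ touch (here refl) (there (here refl)) (subst (_~ β (4 + e)) returns (α'β (4 + e))) ∷ [])
        ∷ (touch (there (here refl)) (here refl) (α'β 1)
          ∷ touch (there (segment-last 2 (1 + e))) (here refl) (αβ (3 + e)) ∷ [])
        ∷ (touch (there (here refl)) (there (there (here refl))) (~-sym (yβ 0)) ∷ [])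
        ∷ [] ∷ []

    x≁y : ∀ {e} → Cycle α (4 + e) → ¬ x ~ y
    x≁y {e} (inj , closed) x~y = K5-minor-free (K5-minor branches connected apart touching)
      where
      branches : Vec (List V) 5
      branches = (x ∷ []) ∷ (y ∷ []) ∷ (α 0 ∷ β 0 ∷ []) ∷ (α 1 ∷ β 1 ∷ [])
               ∷ (β 2 ∷ segment 2 (2 + e)) ∷ []
      connected : VAll.All Connected branches
      connected = [ x ] ∷ [ y ] ∷ attach [ β 0 ] (here refl) (αβ 0) ∷ attach [ β 1 ] (here refl) (αβ 1)
                ∷ attach (segment-connected 2 (1 + e)) (here refl) (~-sym (αβ 2)) ∷ []
      apart : AllPairs Apart branches
      apart =
          (((x≢y ∷ []) ∷ []) ∷ ((x≢α 0 ∷ x≢β 0 ∷ []) ∷ []) ∷ ((x≢α 1 ∷ x≢β 1 ∷ []) ∷ [])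
          ∷ ((x≢β 2 ∷ segment⁺ 2 (2 + e) (λ _ → x≢α _)) ∷ []) ∷ [])
        ∷ (((y≢α 0 ∷ y≢β 0 ∷ []) ∷ []) ∷ ((y≢α 1 ∷ y≢β 1 ∷ []) ∷ [])
          ∷ ((y≢β 2 ∷ segment⁺ 2 (2 + e) (λ _ → y≢α _)) ∷ []) ∷ [])
        ∷ (((α₀≢α₁ ∷ α≢β 0 1 ∷ []) ∷ (≢-sym (α≢β 1 0) ∷ ~-irrefl (ββ 0) ∷ []) ∷ [])
          ∷ ((α≢β 0 2 ∷ segment⁺ 2 (2 + e) (λ i< → distinct-below inj z<s (s<s (s<s i<)) λ ()))
            ∷ (β₀≢β₂ ∷ segment⁺ 2 (2 + e) (λ _ → ≢-sym (α≢β _ 0))) ∷ []) ∷ [])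
        ∷ (((α≢β 1 2 ∷ segment⁺ 2 (2 + e) (λ i< → distinct-below inj (s<s z<s) (s<s (s<s i<)) λ ()))
            ∷ (~-irrefl (ββ 1) ∷ segment⁺ 2 (2 + e) (λ _ → ≢-sym (α≢β _ 1))) ∷ []) ∷ [])
        ∷ [] ∷ []
      touching : AllPairs Touching branches
      touching =
          (heads x~y ∷ heads (xα 0) ∷ heads (xα 1) ∷ touch (here refl) (there (here refl)) (xα 2) ∷ [])
        ∷ (touch (here refl) (there (here refl)) (yβ 0) ∷ touch (here refl) (there (here refl)) (yβ 1)
          ∷ heads (yβ 2) ∷ [])
        ∷ (heads (αα 0) ∷ touch (here refl) (there (segment-last 2 (1 + e))) (cycle-closing-edge closed) ∷ [])
        ∷ (touch (here refl) (there (here refl)) (αα 1) ∷ [])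
        ∷ [] ∷ []

    no-cross-chord : ∀ {e p} → Cycle α (4 + e) → InjectiveBelow β (4 + e) → p ≤ e →
                     ¬ β 0 ~ α (2 + p)
    no-cross-chord {p = p} (inj , closed) injβ p≤e cross with m≤n⇒∃[o]m+o≡n p≤e
    ... | r , refl = K5-minor-free (K5-minor branches connected apart touching)
      where
      2+p<d : 2 + p < 4 + (p + r)
      2+p<d = s<s (s<s (s<s (m≤n⇒m≤1+n (m≤m+n p r))))
      last<d : 3 + (p + r) < 4 + (p + r)
      last<d = n<1+n _
      branches : Vec (List V) 5
      branches = (x ∷ []) ∷ (α 0 ∷ []) ∷ (α 1 ∷ []) ∷ (α (2 + p) ∷ β 0 ∷ [])
               ∷ (α (3 + (p + r)) ∷ β (3 + (p + r)) ∷ β 1 ∷ y ∷ []) ∷ []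
      connected : VAll.All Connected branches
      connected = [ x ] ∷ [ α 0 ] ∷ [ α 1 ] ∷ attach [ β 0 ] (here refl) (~-sym cross)
                ∷ attach (attach (attach [ y ] (here refl) (~-sym (yβ 1)))
                                 (there (here refl)) (~-sym (yβ _)))
                         (here refl) (αβ _)
                ∷ []
      apart : AllPairs Apart branches
      apart =
          (((x≢α 0 ∷ []) ∷ []) ∷ ((x≢α 1 ∷ []) ∷ []) ∷ ((x≢α _ ∷ x≢β 0 ∷ []) ∷ [])
          ∷ ((x≢α _ ∷ x≢β _ ∷ x≢β 1 ∷ x≢y ∷ []) ∷ []) ∷ [])
        ∷ (((α₀≢α₁ ∷ []) ∷ [])
          ∷ ((distinct-below inj z<s 2+p<d (λ ()) ∷ α≢β 0 0 ∷ []) ∷ [])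
          ∷ ((distinct-below inj z<s last<d (λ ()) ∷ α≢β 0 _ ∷ α≢β 0 1 ∷ α≢y 0 ∷ []) ∷ []) ∷ [])
        ∷ (((distinct-below inj (s<s z<s) 2+p<d (λ ()) ∷ α≢β 1 0 ∷ []) ∷ [])
          ∷ ((distinct-below inj (s<s z<s) last<d (λ ()) ∷ α≢β 1 _ ∷ α≢β 1 1 ∷ α≢y 1 ∷ []) ∷ []) ∷ [])
        ∷ (((distinct-below inj 2+p<d last<d (<⇒≢ (s<s (s<s (s<s (m≤m+n p r)))))
             ∷ α≢β _ _ ∷ α≢β _ 1 ∷ α≢y _ ∷ [])
          ∷ (≢-sym (α≢β _ 0) ∷ distinct-below injβ z<s last<d (λ ()) ∷ ~-irrefl (ββ 0) ∷ ≢-sym (y≢β 0) ∷ [])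
          ∷ [])
          ∷ [])
        ∷ [] ∷ []
      touching : AllPairs Touching branches
      touching =
          (heads (xα 0) ∷ heads (xα 1) ∷ heads (xα _) ∷ heads (xα _) ∷ [])
        ∷ (heads (αα 0) ∷ touch (here refl) (there (here refl)) (αβ 0)
          ∷ heads (cycle-closing-edge closed) ∷ [])
        ∷ (touch (here refl) (there (here refl)) (α'β 0)
          ∷ touch (here refl) (there (there (here refl))) (αβ 1) ∷ [])
        ∷ (touch (there (here refl)) (there (there (here refl))) (ββ 0) ∷ [])
        ∷ [] ∷ []

    cycle-step : ∀ {e} → Cycle α (4 + e) → α (5 + e) ≡ α 1
    cycle-step {e} cyc@(_ , closed) with anyUpTo? (λ i → α (5 + e) Fin.≟ α i) (4 + e)
    ... | no  new                = ⊥-elim (no-exit cyc λ i<d eq → new (_ , i<d , eq))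
    ... | yes (0 , _ , eq)       = ⊥-elim (~-irrefl (αα (4 + e)) (trans closed (sym eq)))
    ... | yes (1 , _ , eq)       = eq
    ... | yes (suc (suc p) , s≤s (s≤s (s≤s p≤1+e)) , eq) with m≤n⇒m<n∨m≡n p≤1+e
    ...   | inj₂ refl      = ⊥-elim (αᵢ₊₂≢αᵢ (3 + e) eq)
    ...   | inj₁ (s≤s p≤e) = ⊥-elim (no-chord cyc p≤e (subst₂ _~_ closed eq (αα (4 + e))))

    return-time : ∀ {g} → α (suc g) ≡ α 0 → ∃ λ e → g ≡ 3 + e
    return-time {0}                 eq = ⊥-elim (α₀≢α₁ (sym eq))
    return-time {1}                 eq = ⊥-elim (αᵢ₊₂≢αᵢ 0 eq)
    return-time {2}                 eq = ⊥-elim (αᵢ₊₃≢αᵢ 0 eq)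
    return-time {suc (suc (suc e))} _  = e , refl

  module Periodicity (f : GV → V) (hom : IsHomG H f) where

    open Minors f hom
    private module At t = Minors (f ∘ shift t) (IsHomG-∘ (shift-endo t) hom)

    cycle-periodic : ∀ {e} → Cycle α (4 + e) → ExactPeriod α (4 + e)
    cycle-periodic cyc zero    = Cycle-resp (λ i → cong α (sym (+-identityʳ i))) cyc
    cycle-periodic {e} cyc (suc t) =
      Cycle-resp (λ i → cong α (sym (+-suc i t))) (Cycle-suc cycle-at-t (At.cycle-step t cycle-at-t))
      where
      cycle-at-t : Cycle (λ i → α (i + t)) (4 + e)
      cycle-at-t = cycle-periodic cyc t

    no-late-repetition : ∀ {s k} → suc s < k → α k ≡ α (suc s) → InjectiveBelow α k → ⊥
    no-late-repetition {s} s<k eq inj with m≤n⇒∃[o]m+o≡n s<k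
    ... | o , refl with At.return-time (suc s) (trans (cong (α ∘ suc) (+-comm o (suc s))) eq)
    ...   | e , refl = At.no-entry s (InjectiveBelow-window s (subst (InjectiveBelow α) k≡ inj))
                                     (trans (cong α (sym k≡)) eq)
      where
      k≡ : suc (suc (s + (3 + e))) ≡ 5 + e + s
      k≡ = cong (λ m → suc (suc m)) (+-comm s (3 + e))

    initial-cycle : ∃ λ e → Cycle α (4 + e)
    initial-cycle with first-repetition α
    ... | suc s , k , s<k , eq , inj = ⊥-elim (no-late-repetition s<k eq inj)
    ... | zero  , zero  , () , _
    ... | zero  , suc g , _ , eq , inj with return-time eq
    ...   | e , refl = e , inj , eq

    exact-period : ∃ λ e → ExactPeriod α (4 + e)
    exact-period = let e , cyc = initial-cycle in e , cycle-periodic cyc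

  module _ (f : GV → V) (hom : IsHomG H f) where

    open Minors f hom
    private
      turned-hom : IsHomG H (f ∘ halfShift)
      turned-hom = IsHomG-∘ halfShift-endo hom
      module Turned = Minors (f ∘ halfShift) turned-hom

    common-period : ∃ λ e → ExactPeriod α (4 + e) × ExactPeriod β (4 + e)
    common-period with Periodicity.exact-period f hom | Periodicity.exact-period (f ∘ halfShift) turned-hom
    ... | e , Pα | e′ , Pβ with <-cmp e e′
    ...   | tri≈ _ refl _ = e , Pα , Pβ
    ...   | tri< e<e′ _ _ = ⊥-elim (no-period-mismatch cycleα (cycle-step cycleα)
              (InjectiveBelow-mono (s≤s (s≤s (s≤s (s≤s e<e′)))) (proj₁ (ExactPeriod⇒Cycle Pβ))))
      where
      cycleα : Cycle α (4 + e)
      cycleα = ExactPeriod⇒Cycle Pα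
    ...   | tri> _ _ e′<e = ⊥-elim (Turned.no-period-mismatch cycleβ (Turned.cycle-step cycleβ)
              (InjectiveBelow-mono (s≤s (s≤s (s≤s (s≤s e′<e))))
                 (InjectiveBelow-resp (λ i → cong α (+-comm i 1)) (proj₁ (Pα 1)))))
      where
      cycleβ : Cycle β (4 + e′)
      cycleβ = ExactPeriod⇒Cycle Pβ

  module Chords (f : GV → V) (hom : IsHomG H f) {e} (Pα : ExactPeriod (Image.α f hom) (4 + e)) where

    open Minors f hom
    private module At t = Minors (f ∘ shift t) (IsHomG-∘ (shift-endo t) hom)

    α-chord : ∀ t {k} → k < 4 + e → α t ~ α (k + t) → k ≡ 1 ⊎ k ≡ 3 + e
    α-chord t {0}           _ α~α = ⊥-elim (~-irrefl α~α refl)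
    α-chord t {1}           _ _   = inj₁ refl
    α-chord t {suc (suc p)} (s≤s (s≤s (s≤s p≤1+e))) α~α with m≤n⇒m<n∨m≡n p≤1+e
    ... | inj₂ refl      = inj₂ refl
    ... | inj₁ (s≤s p≤e) = ⊥-elim (At.no-chord t (Pα t) p≤e α~α)

    α~α⇒consecutive : ∀ {i j} → i < 4 + e → j < 4 + e → α i ~ α j → α j ≡ α (suc i) ⊎ α i ≡ α (suc j)
    α~α⇒consecutive {i} i<d j<d α~α with period-offset Pα i<d j<d
    ... | k , k<d , same with α-chord i k<d (subst (α i ~_) (sym (same 0)) α~α)
    ...   | inj₁ refl = inj₁ (sym (same 0))
    ...   | inj₂ refl = inj₂ (trans (sym (period Pα i)) (same 1))

    module _ (Pβ : ExactPeriod β (4 + e)) where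

      β-α-edge : ∀ t {k} → k < 4 + e → β t ~ α (k + t) → k ≡ 0 ⊎ k ≡ 1
      β-α-edge t {0}           _ _   = inj₁ refl
      β-α-edge t {1}           _ _   = inj₂ refl
      β-α-edge t {suc (suc p)} (s≤s (s≤s (s≤s p≤1+e))) β~α with m≤n⇒m<n∨m≡n p≤1+e
      ... | inj₂ refl      = ⊥-elim (βᵢ₊₁≁αᵢ (3 + e + t) (subst (_~ α (3 + e + t)) (sym (period Pβ t)) β~α))
      ... | inj₁ (s≤s p≤e) = ⊥-elim (At.no-cross-chord t (Pα t) (proj₁ (Pβ t)) p≤e β~α)

      α~β⇒aligned : ∀ {i j} → i < 4 + e → j < 4 + e → α i ~ β j → α i ≡ α j ⊎ α i ≡ α (suc j)
      α~β⇒aligned {j = j} i<d j<d α~β with period-offset Pα j<d i<d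
      ... | k , k<d , same with β-α-edge j k<d (subst (β j ~_) (sym (same 0)) (~-sym α~β))
      ...   | inj₁ refl = inj₁ (sym (same 0))
      ...   | inj₂ refl = inj₂ (sym (same 0))

  module Embedding (f : GV → V) (hom : IsHomG H f) {e}
                   (Pα : ExactPeriod (Image.α f hom) (4 + e)) (Pβ : ExactPeriod (Image.β f hom) (4 + e)) where

    open Minors f hom
    open Chords f hom Pα
    private
      turned-hom : IsHomG H (f ∘ halfShift)
      turned-hom = IsHomG-∘ halfShift-endo hom
      module Turned = Chords (f ∘ halfShift) turned-hom Pβ

    embed : DV (4 + e) → V
    embed v₁    = x
    embed v₂    = y
    embed (a i) = α (toℕ i)
    embed (b i) = β (toℕ i)

    factors : ∀ u → f u ≡ embed (δ (4 + e) u)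
    factors v₁    = refl
    factors v₂    = refl
    factors (a i) = sym (period-mod Pα i)
    factors (b i) = sym (period-mod Pβ i)

    α-injective : ∀ {i j : Fin (4 + e)} → α (toℕ i) ≡ α (toℕ j) → i ≡ j
    α-injective = InjectiveBelow-Fin (proj₁ (ExactPeriod⇒Cycle Pα))

    β-injective : ∀ {i j : Fin (4 + e)} → β (toℕ i) ≡ β (toℕ j) → i ≡ j
    β-injective = InjectiveBelow-Fin (proj₁ (ExactPeriod⇒Cycle Pβ))

    α-next : ∀ i → α (toℕ (next (4 + e) i)) ≡ α (suc (toℕ i))
    α-next i = period-mod Pα (suc (toℕ i))

    β-next : ∀ i → β (toℕ (next (4 + e) i)) ≡ β (suc (toℕ i))
    β-next i = period-mod Pβ (suc (toℕ i))

    y≁α : ∀ j → ¬ y ~ α j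
    y≁α j y~α = y≁αᵢ₊₁ (3 + e + j) (subst (y ~_) (sym (period Pα j)) y~α)

    embed-injective : ∀ u v → embed u ≡ embed v → u ≡ v
    embed-injective v₁    v₁    _  = refl
    embed-injective v₁    v₂    eq = ⊥-elim (x≢y eq)
    embed-injective v₁    (a _) eq = ⊥-elim (x≢α _ eq)
    embed-injective v₁    (b _) eq = ⊥-elim (x≢β _ eq)
    embed-injective v₂    v₁    eq = ⊥-elim (x≢y (sym eq))
    embed-injective v₂    v₂    _  = refl
    embed-injective v₂    (a _) eq = ⊥-elim (y≢α _ eq)
    embed-injective v₂    (b _) eq = ⊥-elim (y≢β _ eq)
    embed-injective (a _) v₁    eq = ⊥-elim (x≢α _ (sym eq))
    embed-injective (a _) v₂    eq = ⊥-elim (y≢α _ (sym eq))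
    embed-injective (a _) (a _) eq = cong a (α-injective eq)
    embed-injective (a _) (b _) eq = ⊥-elim (α≢β _ _ eq)
    embed-injective (b _) v₁    eq = ⊥-elim (x≢β _ (sym eq))
    embed-injective (b _) v₂    eq = ⊥-elim (y≢β _ (sym eq))
    embed-injective (b _) (a _) eq = ⊥-elim (α≢β _ _ (sym eq))
    embed-injective (b _) (b _) eq = cong b (β-injective eq)

    embed-arc : ∀ {u v} → DArc (4 + e) u v → embed u ~ embed v
    embed-arc (v₁a i) = xα _
    embed-arc (v₂b i) = yβ _
    embed-arc (ab i)  = αβ _
    embed-arc (aa i)  = subst (α (toℕ i) ~_) (sym (α-next i)) (αα _)
    embed-arc (bb i)  = subst (β (toℕ i) ~_) (sym (β-next i)) (ββ _)
    embed-arc (a'b i) = subst (_~ β (toℕ i)) (sym (α-next i)) (α'β _)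

    embed-edge : ∀ {u v} → DEdge (4 + e) u v → embed u ~ embed v
    embed-edge (inj₁ uv) = embed-arc uv
    embed-edge (inj₂ vu) = ~-sym (embed-arc vu)

    αα-edge : ∀ {i j} → α (toℕ j) ≡ α (suc (toℕ i)) ⊎ α (toℕ i) ≡ α (suc (toℕ j)) → DEdge (4 + e) (a i) (a j)
    αα-edge {i} (inj₁ eq) with refl ← α-injective (trans eq (sym (α-next i))) = inj₁ (aa i)
    αα-edge {j = j} (inj₂ eq) with refl ← α-injective (trans eq (sym (α-next j))) = inj₂ (aa j)

    ββ-edge : ∀ {i j} → β (toℕ j) ≡ β (suc (toℕ i)) ⊎ β (toℕ i) ≡ β (suc (toℕ j)) → DEdge (4 + e) (b i) (b j)
    ββ-edge {i} (inj₁ eq) with refl ← β-injective (trans eq (sym (β-next i))) = inj₁ (bb i)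
    ββ-edge {j = j} (inj₂ eq) with refl ← β-injective (trans eq (sym (β-next j))) = inj₂ (bb j)

    αβ-edge : ∀ {i j} → α (toℕ i) ≡ α (toℕ j) ⊎ α (toℕ i) ≡ α (suc (toℕ j)) → DEdge (4 + e) (a i) (b j)
    αβ-edge (inj₁ eq) with refl ← α-injective eq = inj₁ (ab _)
    αβ-edge {j = j} (inj₂ eq) with refl ← α-injective (trans eq (sym (α-next j))) = inj₁ (a'b j)

    edge-embed : ∀ u v → embed u ~ embed v → DEdge (4 + e) u v
    edge-embed v₁    v₁    h = ⊥-elim (~-irrefl h refl)
    edge-embed v₁    v₂    h = ⊥-elim (x≁y (ExactPeriod⇒Cycle Pα) h)
    edge-embed v₁    (a i) _ = inj₁ (v₁a i)
    edge-embed v₁    (b _) h = ⊥-elim (x≁β _ h)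
    edge-embed v₂    v₁    h = ⊥-elim (x≁y (ExactPeriod⇒Cycle Pα) (~-sym h))
    edge-embed v₂    v₂    h = ⊥-elim (~-irrefl h refl)
    edge-embed v₂    (a _) h = ⊥-elim (y≁α _ h)
    edge-embed v₂    (b i) _ = inj₁ (v₂b i)
    edge-embed (a i) v₁    _ = inj₂ (v₁a i)
    edge-embed (a _) v₂    h = ⊥-elim (y≁α _ (~-sym h))
    edge-embed (a i) (a j) h = αα-edge (α~α⇒consecutive (Fin.toℕ<n i) (Fin.toℕ<n j) h)
    edge-embed (a i) (b j) h = αβ-edge (α~β⇒aligned Pβ (Fin.toℕ<n i) (Fin.toℕ<n j) h)
    edge-embed (b _) v₁    h = ⊥-elim (x≁β _ (~-sym h))
    edge-embed (b i) v₂    _ = inj₂ (v₂b i)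
    edge-embed (b i) (a j) h = swap (αβ-edge (α~β⇒aligned Pβ (Fin.toℕ<n j) (Fin.toℕ<n i) (~-sym h)))
    edge-embed (b i) (b j) h = ββ-edge (Turned.α~α⇒consecutive (Fin.toℕ<n i) (Fin.toℕ<n j) h)

    embedding : IsEmbeddingD (4 + e) H embed
    embedding = embed-injective , λ u v → mk⇔ embed-edge (edge-embed u v)

lemma5p5 : (H : FinGraph) (f : GV → Fin (n H)) → IsHomG H f →
    ¬ HasK4Subgraph H → ¬ HasK5Minor H →
    Σ ℕ λ k → Σ (DV (4 + k) → Fin (n H)) λ f̂ →
      IsEmbeddingD (4 + k) H f̂ × (∀ x → f x ≡ f̂ (δ (4 + k) x))
lemma5p5 H f hom K4-free K5-minor-free =
  let e , Pα , Pβ = common-period K4-free K5-minor-free f hom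
      open Embedding K4-free K5-minor-free f hom Pα Pβ
  in e , embed , embedding , factors
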